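{- Let $T$ be a tree on $n \geq 3$ vertices. Then $T$ is saturated if and only if $T = K_{1,n-1}$.
   Context: All graphs are finite and simple. A degree monotone path in a graph $G$ is a path $v_1v_2\ldots v_m$ such that $\deg(v_1)\le\cdots\le\deg(v_m)$ or $\deg(v_1)\ge\cdots\ge\deg(v_m)$, where degrees are taken in $G$. Its length is its number of vertices $m$. $mp(G)$ denotes the maximum length of a degree monotone path in $G$. A graph $G$ is called saturated if $mp(G+e) > mp(G)$ for every edge $e$ joining two nonadjacent vertices of $G$, where $G+e$ is $G$ with $e$ added. -}

module Defs where

open import Data.Nat using (ℕ; zero; suc; _+_; _≤_; _≥_; _<_)
open import Data.Bool using (Bool; true; false; _∨_; _∧_; if_then_else_; not)
open import Data.Fin using (Fin)
open import Data.Fin.Properties using (_≟_)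
open import Data.List using (List; []; _∷_; length; map; allFin; _∷ʳ_)
open import Data.Nat.ListAction using (sum)
open import Data.Empty using (⊥)
open import Data.List.Relation.Unary.Unique.Propositional using (Unique)
open import Data.List.Relation.Unary.Linked using (Linked)
open import Data.Product using (Σ; ∃; _×_)
open import Data.Sum using (_⊎_)
open import Relation.Nullary using (¬_; ⌊_⌋)
open import Relation.Binary.PropositionalEquality using (_≡_; _≢_)
open import Function.Bundles using (_↔_; Inverse)

Graph : ℕ → Set
Graph n = Fin n → Fin n → Bool

IsSimple : ∀ {n} → Graph n → Set
IsSimple {n} G = (∀ i j → G i j ≡ G j i) × (∀ i → G i i ≡ false)

Adj : ∀ {n} → Graph n → Fin n → Fin n → Set
Adj G i j = G i j ≡ true

deg : ∀ {n} → Graph n → Fin n → ℕ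
deg {n} G i = sum (map (λ j → if G i j then 1 else 0) (allFin n))

IsPath : ∀ {n} → Graph n → List (Fin n) → Set
IsPath G xs = Unique xs × Linked (Adj G) xs

IsDegMonotonePath : ∀ {n} → Graph n → List (Fin n) → Set
IsDegMonotonePath G xs =
  IsPath G xs ×
  (Linked (λ a b → deg G a ≤ deg G b) xs ⊎ Linked (λ a b → deg G a ≥ deg G b) xs)

-- m is the maximum length (number of vertices) of a degree monotone path: m = mp(G)
IsMP : ∀ {n} → Graph n → ℕ → Set
IsMP G m =
  (∃ λ xs → IsDegMonotonePath G xs × length xs ≡ m) ×
  (∀ xs → IsDegMonotonePath G xs → length xs ≤ m)

addEdge : ∀ {n} → Graph n → Fin n → Fin n → Graph n
addEdge G u v i j =
  G i j ∨ ((⌊ i ≟ u ⌋ ∧ ⌊ j ≟ v ⌋) ∨ (⌊ i ≟ v ⌋ ∧ ⌊ j ≟ u ⌋))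

Saturated : ∀ {n} → Graph n → Set
Saturated {n} G =
  ∀ (u v : Fin n) → u ≢ v → ¬ Adj G u v →
  ∀ m m' → IsMP G m → IsMP (addEdge G u v) m' → m < m'

Connected : ∀ {n} → Graph n → Set
Connected {n} G =
  ∀ (u v : Fin n) → u ≡ v ⊎ ∃ λ xs → Linked (Adj G) (u ∷ (xs ∷ʳ v))

IsCycle : ∀ {n} → Graph n → List (Fin n) → Set
IsCycle G [] = ⊥
IsCycle G (x ∷ xs) =
  3 ≤ length (x ∷ xs) × IsPath G (x ∷ xs) × Linked (Adj G) ((x ∷ xs) ∷ʳ x)

Acyclic : ∀ {n} → Graph n → Set
Acyclic G = ∀ xs → ¬ IsCycle G xs

IsTree : ∀ {n} → Graph n → Set
IsTree G = IsSimple G × Connected G × Acyclic G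

Star : (m : ℕ) → Graph (suc m)
Star m i j = not ⌊ i ≟ j ⌋ ∧ (⌊ i ≟ Fin.zero ⌋ ∨ ⌊ j ≟ Fin.zero ⌋)

Isomorphic : ∀ {n} → Graph n → Graph n → Set
Isomorphic {n} G H =
  Σ (Fin n ↔ Fin n) λ f → ∀ i j → G i j ≡ H (Inverse.to f i) (Inverse.to f j)

module Submission where

-- Stars are saturated (StarSaturated): every degree monotone path has at most two vertices,
-- while joining two leaves u, v gives the monotone path u v c through the centre c.
--
-- Conversely (LeafToHub, NonStarTree), a tree without a dominating vertex is not
-- saturated.  Let u have maximum degree and let v w … u be a longest path ending at u; then
-- v is a leaf not adjacent to u.  In G + uv the vertex u is the unique maximum and v has
-- degree 2, and every degree monotone path of G + uv is matched by one of G with at least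
-- as many vertices: either it is already one, or it starts at v (possibly after u), runs
-- along the path towards u through vertices of degree 2, and is replaced by that stretch of
-- the path prolonged by one vertex.  A tree with a dominating vertex is a star, since an
-- edge avoiding the centre would close a triangle.

open import Defs
open import Data.Nat using (ℕ; zero; suc; _+_; _≤_; _≥_; _≤?_; z≤n; s≤s; s≤s⁻¹)
open import Data.Nat.Properties
  using ( ≤-refl; ≤-trans; ≤-reflexive; ≤-antisym; <-≤-trans; <⇒≱; ≤∧≢⇒<; n≤1+n; m≤m+n; m≤n+m
        ; +-mono-≤; +-comm; +-0-commutativeMonoid; module ≤-Reasoning)
open import Data.Bool using (Bool; true; false; if_then_else_; not; _∨_; _∧_)
open import Data.Bool.Properties using (∨-zeroʳ; ∨-identityʳ; ∨-comm; ∧-comm; ∧-zeroʳ; ¬-not)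
import Data.Bool.Properties as Bool
open import Data.Fin using (Fin; zero; suc)
open import Data.Fin.Properties using (_≟_; any?; all?; ¬∀⟶∃¬)
open import Data.Fin.Permutation using (Permutation′; transpose; _⟨$⟩ʳ_; _⟨$⟩ˡ_; inverseˡ)
open import Data.List using (List; []; _∷_; _++_; _∷ʳ_; length; map; tabulate; allFin; reverse; reverseAcc)
open import Data.List.Properties using (++-identityʳ; ++-assoc; ∷-injectiveʳ; length-++; length-reverse)
import Data.Nat.ListAction as ListSum
open import Data.List.Extrema.Nat using (argmax; f[xs]≤f[argmax])
open import Data.List.Relation.Unary.All as All using (All; []; _∷_)
import Data.List.Relation.Unary.All.Properties as AllP
open import Data.List.Relation.Unary.Any using (here; there)
open import Data.List.Membership.Propositional using (_∈_; _∉_)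
open import Data.List.Membership.Propositional.Properties using (∈-++⁺ʳ; ∈-∃++; ∈-allFin)
import Data.List.Membership.DecPropositional as MemDec
open import Data.List.Relation.Unary.Linked as Linked using (Linked; []; [-]; _∷_; linked?)
open import Data.List.Relation.Unary.Unique.Propositional as Unique using (Unique; []; _∷_)
open import Data.List.Relation.Unary.Unique.Propositional.Properties using (Unique[x∷xs]⇒x∉xs)
import Data.List.Relation.Unary.Unique.DecPropositional as UniqueDec
open import Data.List.Relation.Binary.Permutation.Propositional using (↭-sym; ↭⇒↭ₛ)
open import Data.List.Relation.Binary.Permutation.Propositional.Properties using (↭-reverse)
import Data.List.Relation.Binary.Permutation.Setoid.Properties as PermProps
open import Data.Product using (∃; _×_; _,_; proj₁; proj₂)
open import Data.Sum using (_⊎_; inj₁; inj₂)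
open import Data.Empty using (⊥-elim)
open import Data.Unit using (⊤)
open import Relation.Nullary using (¬_; Dec; yes; no; does; ⌊_⌋; _×-dec_; _⊎-dec_)
import Relation.Nullary.Decidable as Dec
open import Relation.Nullary.Decidable using (dec-true; dec-false; isYes≗does; does-⇔)
open import Relation.Binary.PropositionalEquality
  using (_≡_; _≢_; refl; sym; trans; cong; cong₂; subst; subst₂; setoid; module ≡-Reasoning)
open import Algebra.Properties.CommutativeMonoid.Sum +-0-commutativeMonoid
  using (∑-distrib-+; sum-cong-≗) renaming (sum to ∑)
open import Function using (_∘_; id; flip)
open import Function.Bundles using (_⇔_; mk⇔; Inverse; Equivalence)

ind : Bool → ℕ
ind b = if b then 1 else 0

ind≤1 : ∀ b → ind b ≤ 1
ind≤1 true = ≤-refl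
ind≤1 false = z≤n

deg≡∑ : ∀ {n} (G : Graph n) x → deg G x ≡ ∑ (ind ∘ G x)
deg≡∑ {n} G x = go n (G x) id
  where
  go : ∀ k (row : Fin n → Bool) (g : Fin k → Fin n) →
       ListSum.sum (map (ind ∘ row) (tabulate g)) ≡ ∑ (ind ∘ row ∘ g)
  go zero row g = refl
  go (suc k) row g = cong (ind (row (g zero)) +_) (go k row (g ∘ suc))

∑-mono : ∀ {n} (f g : Fin n → ℕ) → (∀ j → f j ≤ g j) → ∑ f ≤ ∑ g
∑-mono {zero} f g le = z≤n
∑-mono {suc n} f g le = +-mono-≤ (le zero) (∑-mono (f ∘ suc) (g ∘ suc) (le ∘ suc))

δ : ∀ {n} → Fin n → Fin n → ℕ
δ a j = ind (does (j ≟ a))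

∑-zero : ∀ n → ∑ {n} (λ _ → 0) ≡ 0
∑-zero zero = refl
∑-zero (suc n) = ∑-zero n

∑-δ : ∀ {n} (a : Fin n) → ∑ (δ a) ≡ 1
∑-δ {suc n} zero = cong suc (∑-zero n)
∑-δ {suc n} (suc a) = ∑-δ a

hits : ∀ {n} → List (Fin n) → Fin n → ℕ
hits [] j = 0
hits (a ∷ L) j = δ a j + hits L j

∑-hits : ∀ {n} (L : List (Fin n)) → ∑ (hits L) ≡ length L
∑-hits {n} [] = ∑-zero n
∑-hits (a ∷ L) = trans (∑-distrib-+ (δ a) (hits L)) (cong₂ _+_ (∑-δ a) (∑-hits L))

δ-self : ∀ {n} (a : Fin n) → δ a a ≡ 1
δ-self a = cong ind (dec-true (a ≟ a) refl)

δ-other : ∀ {n} {a j : Fin n} → j ≢ a → δ a j ≡ 0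
δ-other {a = a} {j} j≢a = cong ind (dec-false (j ≟ a) j≢a)

hits-∉ : ∀ {n} {j : Fin n} L → j ∉ L → hits L j ≡ 0
hits-∉ [] j∉L = refl
hits-∉ {j = j} (a ∷ L) j∉L = cong₂ _+_ (δ-other {a = a} {j} (j∉L ∘ here)) (hits-∉ L (j∉L ∘ there))

hits-∈ : ∀ {n} {j : Fin n} {L} → j ∈ L → 1 ≤ hits L j
hits-∈ {j = j} (here refl) = ≤-trans (≤-reflexive (sym (δ-self j))) (m≤m+n _ _)
hits-∈ {j = j} {a ∷ _} (there j∈L) = ≤-trans (hits-∈ j∈L) (m≤n+m _ (δ a j))

length≤∑ : ∀ {n} (f : Fin n → ℕ) {L} → Unique L → All (λ j → 1 ≤ f j) L → length L ≤ ∑ f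
length≤∑ f {L} uq pos = ≤-trans (≤-reflexive (sym (∑-hits L))) (∑-mono (hits L) f (pointwise uq pos))
  where
  pointwise : ∀ {L} → Unique L → All (λ j → 1 ≤ f j) L → ∀ j → hits L j ≤ f j
  pointwise [] [] j = z≤n
  pointwise {a ∷ L} (a∉L ∷ uq) (fa ∷ pos) j with j ≟ a
  ... | yes refl = subst (λ k → suc k ≤ f j) (sym (hits-∉ L (Unique[x∷xs]⇒x∉xs (a∉L ∷ uq)))) fa
  ... | no _ = pointwise uq pos j

∑≤length : ∀ {n} (f : Fin n → ℕ) L → (∀ j → f j ≤ 1) → (∀ j → 1 ≤ f j → j ∈ L) → ∑ f ≤ length L
∑≤length f L ≤1 cover = ≤-trans (∑-mono f (hits L) pointwise) (≤-reflexive (∑-hits L))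
  where
  pointwise : ∀ j → f j ≤ hits L j
  pointwise j with f j in fj
  ... | zero = z≤n
  ... | suc k = ≤-trans (subst (_≤ 1) fj (≤1 j)) (hits-∈ (cover j (≤-trans (s≤s z≤n) (≤-reflexive (sym fj)))))

unique-length : ∀ {n} {L : List (Fin n)} → Unique L → length L ≤ n
unique-length {n} {L} uq = ≤-trans (length≤∑ (λ _ → 1) uq (All.tabulate (λ _ → ≤-refl))) (≤-reflexive (∑-one n))
  where
  ∑-one : ∀ k → ∑ {k} (λ _ → 1) ≡ k
  ∑-one zero = refl
  ∑-one (suc k) = cong suc (∑-one k)

ind-true : ∀ {b} → b ≡ true → 1 ≤ ind b
ind-true refl = ≤-refl

ind-pos : ∀ {b} → 1 ≤ ind b → b ≡ true
ind-pos {true} _ = refl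
ind-pos {false} ()

length≤deg : ∀ {n} (G : Graph n) x {L} → Unique L → All (Adj G x) L → length L ≤ deg G x
length≤deg G x uq adj =
  subst (_ ≤_) (sym (deg≡∑ G x)) (length≤∑ (ind ∘ G x) uq (All.map ind-true adj))

deg≤length : ∀ {n} (G : Graph n) x L → (∀ j → Adj G x j → j ∈ L) → deg G x ≤ length L
deg≤length G x L cover =
  subst (_≤ _) (sym (deg≡∑ G x)) (∑≤length (ind ∘ G x) L (ind≤1 ∘ G x) (λ j → cover j ∘ ind-pos))

deg-cong : ∀ {n} (G H : Graph n) x y → (∀ j → G x j ≡ H y j) → deg G x ≡ deg H y
deg-cong G H x y same = begin
  deg G x            ≡⟨ deg≡∑ G x ⟩
  ∑ (ind ∘ G x)      ≡⟨ sum-cong-≗ (cong ind ∘ same) ⟩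
  ∑ (ind ∘ H y)      ≡⟨ deg≡∑ H y ⟨
  deg H y            ∎
  where open ≡-Reasoning

deg-grows : ∀ {n} (G H : Graph n) x a → (∀ j → Adj G x j → Adj H x j) →
            ¬ Adj G x a → Adj H x a → suc (deg G x) ≤ deg H x
deg-grows {n} G H x a keep ¬old new = begin
  suc (deg G x)                     ≡⟨ +-comm 1 (deg G x) ⟩
  deg G x + 1                       ≡⟨ cong₂ _+_ (deg≡∑ G x) (sym (∑-δ a)) ⟩
  ∑ (ind ∘ G x) + ∑ (δ a)           ≡⟨ ∑-distrib-+ (ind ∘ G x) (δ a) ⟨
  ∑ (λ j → ind (G x j) + δ a j)     ≤⟨ ∑-mono _ _ pointwise ⟩
  ∑ (ind ∘ H x)                     ≡⟨ deg≡∑ H x ⟨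
  deg H x                           ∎
  where
  open ≤-Reasoning
  pointwise : ∀ j → ind (G x j) + δ a j ≤ ind (H x j)
  pointwise j with j ≟ a | G x j in old
  ... | yes refl | true = ⊥-elim (¬old old)
  ... | yes refl | false = ind-true new
  ... | no _ | true = ind-true (keep j old)
  ... | no _ | false = z≤n

Symmetric : ∀ {n} → Graph n → Set
Symmetric G = ∀ i j → G i j ≡ G j i

adj-sym : ∀ {n} {G : Graph n} → Symmetric G → ∀ {a b} → Adj G a b → Adj G b a
adj-sym symG {a} {b} e = trans (symG b a) e

adj-irrefl : ∀ {n} {G : Graph n} → (∀ i → G i i ≡ false) → ∀ {a b} → Adj G a b → a ≢ b
adj-irrefl loopless {a} e refl with trans (sym (loopless a)) e
... | ()

isYes-witness : ∀ {A : Set} (d : Dec A) → ⌊ d ⌋ ≡ true → A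
isYes-witness (yes a) _ = a

∨-cases : ∀ g a b c d → g ∨ ((a ∧ b) ∨ (c ∧ d)) ≡ true →
          g ≡ true ⊎ (a ≡ true × b ≡ true) ⊎ (c ≡ true × d ≡ true)
∨-cases true _ _ _ _ _ = inj₁ refl
∨-cases false true true _ _ _ = inj₂ (inj₁ (refl , refl))
∨-cases false _ _ true true _ = inj₂ (inj₂ (refl , refl))
∨-cases false false _ false _ ()
∨-cases false false _ true false ()
∨-cases false true false false _ ()
∨-cases false true false true false ()

addEdge-cases : ∀ {n} (G : Graph n) u v i j → Adj (addEdge G u v) i j →
                Adj G i j ⊎ (i ≡ u × j ≡ v) ⊎ (i ≡ v × j ≡ u)
addEdge-cases G u v i j e with ∨-cases (G i j) ⌊ i ≟ u ⌋ ⌊ j ≟ v ⌋ ⌊ i ≟ v ⌋ ⌊ j ≟ u ⌋ e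
... | inj₁ ij = inj₁ ij
... | inj₂ (inj₁ (p , q)) = inj₂ (inj₁ (isYes-witness (i ≟ u) p , isYes-witness (j ≟ v) q))
... | inj₂ (inj₂ (p , q)) = inj₂ (inj₂ (isYes-witness (i ≟ v) p , isYes-witness (j ≟ u) q))

addEdge-old : ∀ {n} (G : Graph n) u v {i j} → Adj G i j → Adj (addEdge G u v) i j
addEdge-old G u v e rewrite e = refl

addEdge-uv : ∀ {n} (G : Graph n) u v → Adj (addEdge G u v) u v
addEdge-uv G u v with u ≟ u | v ≟ v
... | yes _ | yes _ = ∨-zeroʳ (G u v)
... | no u≢u | _ = ⊥-elim (u≢u refl)
... | _ | no v≢v = ⊥-elim (v≢v refl)

addEdge-vu : ∀ {n} (G : Graph n) u v → Adj (addEdge G u v) v u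
addEdge-vu G u v with v ≟ v | u ≟ u
... | yes _ | yes _ = trans (cong (G v u ∨_) (∨-zeroʳ _)) (∨-zeroʳ (G v u))
... | no v≢v | _ = ⊥-elim (v≢v refl)
... | _ | no u≢u = ⊥-elim (u≢u refl)

addEdge-away : ∀ {n} (G : Graph n) u v {i} → i ≢ u → i ≢ v → ∀ j → addEdge G u v i j ≡ G i j
addEdge-away G u v {i} i≢u i≢v j with i ≟ u | i ≟ v
... | yes i≡u | _ = ⊥-elim (i≢u i≡u)
... | _ | yes i≡v = ⊥-elim (i≢v i≡v)
... | no _ | no _ = ∨-identityʳ (G i j)

addEdge-sym : ∀ {n} {G : Graph n} u v → Symmetric G → Symmetric (addEdge G u v)
addEdge-sym {G = G} u v symG i j = cong₂ _∨_ (symG i j) (begin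
  (⌊ i ≟ u ⌋ ∧ ⌊ j ≟ v ⌋) ∨ (⌊ i ≟ v ⌋ ∧ ⌊ j ≟ u ⌋)   ≡⟨ ∨-comm (⌊ i ≟ u ⌋ ∧ ⌊ j ≟ v ⌋) _ ⟩
  (⌊ i ≟ v ⌋ ∧ ⌊ j ≟ u ⌋) ∨ (⌊ i ≟ u ⌋ ∧ ⌊ j ≟ v ⌋)   ≡⟨ cong₂ _∨_ (∧-comm ⌊ i ≟ v ⌋ _) (∧-comm ⌊ i ≟ u ⌋ _) ⟩
  (⌊ j ≟ u ⌋ ∧ ⌊ i ≟ v ⌋) ∨ (⌊ j ≟ v ⌋ ∧ ⌊ i ≟ u ⌋)   ∎)
  where open ≡-Reasoning

module _ {A : Set} where

  linked-reverse : ∀ {R : A → A → Set} {xs} → Linked R xs → Linked (flip R) (reverse xs)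
  linked-reverse {xs = []} _ = []
  linked-reverse {R = R} {x ∷ xs} l = go xs [] l [-]
    where
    go : ∀ {x} ys acc → Linked R (x ∷ ys) → Linked (flip R) (x ∷ acc) →
         Linked (flip R) (reverseAcc (x ∷ acc) ys)
    go [] acc _ done = done
    go (y ∷ ys) acc (r ∷ l) done = go ys (_ ∷ acc) l (r ∷ done)

  unique-reverse : ∀ {xs : List A} → Unique xs → Unique (reverse xs)
  unique-reverse {xs} = PermProps.Unique-resp-↭ (setoid A) (↭⇒↭ₛ (↭-sym (↭-reverse xs)))

  linked-prefix : ∀ {R : A → A → Set} xs {ys} → Linked R (xs ++ ys) → Linked R xs
  linked-prefix [] _ = []
  linked-prefix (x ∷ []) _ = [-]
  linked-prefix (x ∷ y ∷ xs) (r ∷ l) = r ∷ linked-prefix (y ∷ xs) l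

  unique-prefix : ∀ xs {ys : List A} → Unique (xs ++ ys) → Unique xs
  unique-prefix [] _ = []
  unique-prefix (x ∷ xs) (x∉ ∷ uq) = AllP.++⁻ˡ xs x∉ ∷ unique-prefix xs uq

  linked-snoc : ∀ {R : A → A → Set} xs {a b} → Linked R (xs ∷ʳ a) → R a b → Linked R (xs ∷ʳ a ∷ʳ b)
  linked-snoc [] _ r = r ∷ [-]
  linked-snoc (x ∷ []) (r₁ ∷ [-]) r = r₁ ∷ r ∷ [-]
  linked-snoc (x ∷ y ∷ xs) (r₁ ∷ l) r = r₁ ∷ linked-snoc (y ∷ xs) l r

path-prefix : ∀ {n} {G : Graph n} xs {ys} → IsPath G (xs ++ ys) → IsPath G xs
path-prefix xs (uq , lk) = unique-prefix xs uq , linked-prefix xs lk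

sized? : ∀ {N} (P : List (Fin N) → Set) → (∀ xs → Dec (P xs)) →
         ∀ k → Dec (∃ λ xs → P xs × length xs ≡ k)
sized? P P? zero = Dec.map′ (λ p → [] , p , refl) (λ { ([] , p , refl) → p }) (P? [])
sized? P P? (suc k) with any? (λ x → sized? (P ∘ (x ∷_)) (P? ∘ (x ∷_)) k)
... | yes (x , ys , p , refl) = yes (x ∷ ys , p , refl)
... | no none = no λ { (x ∷ ys , p , refl) → none (x , ys , p , refl) }

Longest : ∀ {N} → (List (Fin N) → Set) → List (Fin N) → Set
Longest P xs = P xs × (∀ ys → P ys → length ys ≤ length xs)

longest : ∀ {N} (P : List (Fin N) → Set) → (∀ xs → Dec (P xs)) → P [] →
          (∀ xs → P xs → Unique xs) → ∃ (Longest P)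
longest {N} P P? p[] unique = search N (λ ys → unique-length ∘ unique ys)
  where
  search : ∀ b → (∀ ys → P ys → length ys ≤ b) → ∃ (Longest P)
  search zero bound = [] , p[] , bound
  search (suc b) bound with sized? P P? (suc b)
  ... | yes (xs , pxs , len) = xs , pxs , λ ys pys → subst (length ys ≤_) (sym len) (bound ys pys)
  ... | no none = search b λ ys pys → s≤s⁻¹ (≤∧≢⇒< (bound ys pys) λ eq → none (ys , pys , eq))

path? : ∀ {n} (G : Graph n) xs → Dec (IsPath G xs)
path? G xs = UniqueDec.unique? _≟_ xs ×-dec linked? (λ a b → G a b Bool.≟ true) xs

mp-exists : ∀ {n} (G : Graph n) → ∃ (IsMP G)
mp-exists G with longest (IsDegMonotonePath G) monotone? (([] , []) , inj₁ []) (λ _ → proj₁ ∘ proj₁)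
  where
  monotone? : ∀ xs → Dec (IsDegMonotonePath G xs)
  monotone? xs = path? G xs ×-dec
    (linked? (λ a b → deg G a ≤? deg G b) xs ⊎-dec linked? (λ a b → deg G b ≤? deg G a) xs)
... | xs , mono , max = length xs , (xs , mono , refl) , max

starAt : ∀ {n} → Fin n → Graph n
starAt c i j = not ⌊ i ≟ j ⌋ ∧ (⌊ i ≟ c ⌋ ∨ ⌊ j ≟ c ⌋)

⌊⌋-⇔ : ∀ {A B : Set} → A ⇔ B → (a? : Dec A) (b? : Dec B) → ⌊ a? ⌋ ≡ ⌊ b? ⌋
⌊⌋-⇔ A⇔B a? b? = trans (isYes≗does a?) (trans (does-⇔ A⇔B a? b?) (sym (isYes≗does b?)))

starAt-relabel : ∀ {n} (f : Fin n → Fin n) → (∀ {i j} → f i ≡ f j → i ≡ j) →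
                 ∀ c i j → starAt (f c) (f i) (f j) ≡ starAt c i j
starAt-relabel f inj c i j =
  cong₂ _∧_ (cong not (same i j)) (cong₂ _∨_ (same i c) (same j c))
  where
  same : ∀ a b → ⌊ f a ≟ f b ⌋ ≡ ⌊ a ≟ b ⌋
  same a b = ⌊⌋-⇔ (mk⇔ inj (cong f)) (f a ≟ f b) (a ≟ b)

star-iso : ∀ {m} (T : Graph (suc m)) → Isomorphic T (Star m) ⇔ ∃ λ c → ∀ i j → T i j ≡ starAt c i j
star-iso {m} T = mk⇔ centre relabel
  where
  centre : Isomorphic T (Star m) → ∃ λ c → ∀ i j → T i j ≡ starAt c i j
  centre (f , iso) = from zero , λ i j → begin
    T i j                              ≡⟨ iso i j ⟩
    starAt zero (to i) (to j)          ≡⟨ cong (λ c → starAt c (to i) (to j)) (strictlyInverseˡ zero) ⟨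
    starAt (to (from zero)) (to i) (to j) ≡⟨ starAt-relabel to to-injective (from zero) i j ⟩
    starAt (from zero) i j             ∎
    where
    open Inverse f
    open ≡-Reasoning
    to-injective : ∀ {i j} → to i ≡ to j → i ≡ j
    to-injective {i} {j} eq = trans (sym (strictlyInverseʳ i)) (trans (cong from eq) (strictlyInverseʳ j))
  relabel : (∃ λ c → ∀ i j → T i j ≡ starAt c i j) → Isomorphic T (Star m)
  relabel (c , star) = π , λ i j → begin
    T i j                          ≡⟨ star i j ⟩
    starAt c i j                   ≡⟨ starAt-relabel (π ⟨$⟩ʳ_) π-injective c i j ⟨
    starAt (π ⟨$⟩ʳ c) (π ⟨$⟩ʳ i) (π ⟨$⟩ʳ j) ≡⟨ cong (λ c → starAt c (π ⟨$⟩ʳ i) (π ⟨$⟩ʳ j)) π-c ⟩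
    starAt zero (π ⟨$⟩ʳ i) (π ⟨$⟩ʳ j) ∎
    where
    open ≡-Reasoning
    π : Permutation′ (suc m)
    π = transpose c zero
    π-c : π ⟨$⟩ʳ c ≡ zero
    π-c rewrite dec-true (c ≟ c) refl = refl
    π-injective : ∀ {i j} → π ⟨$⟩ʳ i ≡ π ⟨$⟩ʳ j → i ≡ j
    π-injective {i} {j} eq = trans (sym (inverseˡ π)) (trans (cong (π ⟨$⟩ˡ_) eq) (inverseˡ π))

Centre : ∀ {n} → Graph n → Fin n → Set
Centre G c = (∀ j → j ≢ c → Adj G c j) × (∀ i j → i ≢ c → j ≢ c → ¬ Adj G i j)

star⇒centre : ∀ {n} {G : Graph n} {c} → (∀ i j → G i j ≡ starAt c i j) → Centre G c
star⇒centre {G = G} {c} star = (λ j j≢c → trans (star c j) (hub j j≢c)) ,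
                               (λ i j i≢c j≢c e → true≢false (trans (sym e) (trans (star i j) (rim i j i≢c j≢c))))
  where
  true≢false : true ≢ false
  true≢false ()
  hub : ∀ j → j ≢ c → not ⌊ c ≟ j ⌋ ∧ (⌊ c ≟ c ⌋ ∨ ⌊ j ≟ c ⌋) ≡ true
  hub j j≢c with c ≟ j | c ≟ c
  ... | yes c≡j | _ = ⊥-elim (j≢c (sym c≡j))
  ... | no _ | yes _ = refl
  ... | no _ | no c≢c = ⊥-elim (c≢c refl)
  rim : ∀ i j → i ≢ c → j ≢ c → not ⌊ i ≟ j ⌋ ∧ (⌊ i ≟ c ⌋ ∨ ⌊ j ≟ c ⌋) ≡ false
  rim i j i≢c j≢c with i ≟ c | j ≟ c
  ... | yes i≡c | _ = ⊥-elim (i≢c i≡c)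
  ... | _ | yes j≡c = ⊥-elim (j≢c j≡c)
  ... | no _ | no _ = ∧-zeroʳ (not ⌊ i ≟ j ⌋)

centre⇒star : ∀ {n} {G : Graph n} {c} → IsSimple G → Centre G c →
              ∀ i j → G i j ≡ not ⌊ i ≟ j ⌋ ∧ (⌊ i ≟ c ⌋ ∨ ⌊ j ≟ c ⌋)
centre⇒star {G = G} {c} (symG , loopless) (hub , rim) i j with i ≟ j | i ≟ c | j ≟ c
... | yes refl | _ | _ = loopless i
... | no i≢j | yes refl | _ = hub j (λ j≡i → i≢j (sym j≡i))
... | no _ | no i≢c | yes refl = adj-sym symG (hub i i≢c)
... | no _ | no i≢c | no j≢c = ¬-not (rim i j i≢c j≢c)

module StarSaturated {n} (G : Graph n) (symG : Symmetric G) (c : Fin n) (centre : Centre G c) where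

  leaf-nbr : ∀ {i j} → i ≢ c → Adj G i j → j ≡ c
  leaf-nbr {i} {j} i≢c e with j ≟ c
  ... | yes j≡c = j≡c
  ... | no j≢c = ⊥-elim (proj₂ centre i j i≢c j≢c e)

  leaf-deg : ∀ {i} → i ≢ c → deg G i ≤ 1
  leaf-deg i≢c = deg≤length G _ (c ∷ []) (λ j e → here (leaf-nbr i≢c e))

  -- mp(G) ≤ 2: the middle of a 3-vertex path is c, which has larger degree than both ends
  short : ∀ xs → IsDegMonotonePath G xs → length xs ≤ 2
  short [] _ = z≤n
  short (_ ∷ []) _ = s≤s z≤n
  short (_ ∷ _ ∷ []) _ = s≤s (s≤s z≤n)
  short (a ∷ b ∷ d ∷ rest) ((((a≢b ∷ a≢d ∷ _) ∷ (b≢d ∷ _) ∷ _) , ab ∷ bd ∷ _) , mono) with b ≟ c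
  ... | no b≢c = ⊥-elim (a≢d (trans (leaf-nbr b≢c (adj-sym symG ab)) (sym (leaf-nbr b≢c bd))))
  ... | yes refl = ⊥-elim (<⇒≱ (s≤s ≤-refl) (peak mono))
    where
    b-deg : 2 ≤ deg G b
    b-deg = length≤deg G b ((a≢d ∷ []) ∷ [] ∷ []) (adj-sym symG ab ∷ bd ∷ [])
    peak : Linked (λ x y → deg G x ≤ deg G y) (a ∷ b ∷ d ∷ rest) ⊎
           Linked (λ x y → deg G x ≥ deg G y) (a ∷ b ∷ d ∷ rest) → 2 ≤ 1
    peak (inj₁ (_ ∷ b≤d ∷ _)) = ≤-trans b-deg (≤-trans b≤d (leaf-deg (λ d≡b → b≢d (sym d≡b))))
    peak (inj₂ (a≥b ∷ _)) = ≤-trans b-deg (≤-trans a≥b (leaf-deg a≢b))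

  saturated : Saturated G
  saturated u v u≢v ¬uv _ _ ((xs , mono , refl) , _) (_ , longest') =
    <-≤-trans (s≤s (short xs mono)) (longest' (u ∷ v ∷ c ∷ []) uvc)
    where
    G' : Graph n
    G' = addEdge G u v
    u≢c : u ≢ c
    u≢c refl = ¬uv (proj₁ centre v (λ v≡u → u≢v (sym v≡u)))
    v≢c : v ≢ c
    v≢c refl = ¬uv (adj-sym symG (proj₁ centre u u≢v))
    c-nbr : ∀ {x} → x ≢ c → Adj G' c x
    c-nbr x≢c = addEdge-old G u v (proj₁ centre _ x≢c)
    u-deg : deg G' u ≤ 2
    u-deg = deg≤length G' u (c ∷ v ∷ []) nbrs
      where
      nbrs : ∀ j → Adj G' u j → j ∈ c ∷ v ∷ []
      nbrs j e with addEdge-cases G u v u j e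
      ... | inj₁ e = here (leaf-nbr u≢c e)
      ... | inj₂ (inj₁ (_ , j≡v)) = there (here j≡v)
      ... | inj₂ (inj₂ (u≡v , _)) = ⊥-elim (u≢v u≡v)
    v-deg : deg G' v ≤ 2
    v-deg = deg≤length G' v (c ∷ u ∷ []) nbrs
      where
      nbrs : ∀ j → Adj G' v j → j ∈ c ∷ u ∷ []
      nbrs j e with addEdge-cases G u v v j e
      ... | inj₁ e = here (leaf-nbr v≢c e)
      ... | inj₂ (inj₁ (v≡u , _)) = ⊥-elim (u≢v (sym v≡u))
      ... | inj₂ (inj₂ (_ , j≡u)) = there (here j≡u)
    c≢u : c ≢ u
    c≢u c≡u = u≢c (sym c≡u)
    vc : Adj G' v c
    vc = adj-sym (addEdge-sym u v symG) (c-nbr v≢c)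
    uvc : IsDegMonotonePath G' (u ∷ v ∷ c ∷ [])
    uvc = (((u≢v ∷ u≢c ∷ []) ∷ (v≢c ∷ []) ∷ [] ∷ []) , addEdge-uv G u v ∷ vc ∷ [-]) ,
          inj₁ (≤-trans u-deg (length≤deg G' v ((c≢u ∷ []) ∷ [] ∷ []) (vc ∷ addEdge-vu G u v ∷ [])) ∷
                ≤-trans v-deg (length≤deg G' c ((u≢v ∷ []) ∷ [] ∷ []) (c-nbr u≢c ∷ c-nbr v≢c ∷ [])) ∷ [-])

middle-deg : ∀ {n} {G : Graph n} → Symmetric G → ∀ {p x y rest} → IsPath G (p ∷ x ∷ y ∷ rest) → 2 ≤ deg G x
middle-deg {G = G} symG {x = x} ((_ ∷ p≢y ∷ _) ∷ _ , px ∷ xy ∷ _) =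
  length≤deg G x ((p≢y ∷ []) ∷ [] ∷ []) (adj-sym symG px ∷ xy ∷ [])

interior-deg : ∀ {n} {G : Graph n} → Symmetric G → ∀ p xs q → IsPath G (p ∷ (xs ∷ʳ q)) →
               All (λ z → 2 ≤ deg G z) xs
interior-deg symG p [] q _ = []
interior-deg symG p (x ∷ []) q path = middle-deg symG path ∷ []
interior-deg symG p (x ∷ y ∷ zs) q path@(_ ∷ uq , _ ∷ lk) =
  middle-deg symG path ∷ interior-deg symG x (y ∷ zs) q (uq , lk)

pin : ∀ {n} (G : Graph n) {x L} → deg G x ≤ length L → Unique L → All (Adj G x) L →
      ∀ {y} → Adj G x y → y ∈ L
pin G {x} {L} deg≤ uq adj {y} xy with MemDec._∈?_ _≟_ y L
... | yes y∈L = y∈L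
... | no y∉L = ⊥-elim (<⇒≱ (length≤deg G x (AllP.¬Any⇒All¬ L y∉L ∷ uq) (xy ∷ adj)) deg≤)

addEdge-avoid : ∀ {n} (G : Graph n) u v {xs} → All (_≢ u) xs →
                Linked (Adj (addEdge G u v)) xs → Linked (Adj G) xs
addEdge-avoid G u v _ [] = []
addEdge-avoid G u v _ [-] = [-]
addEdge-avoid G u v (i≢u ∷ j≢u ∷ avoid) (e ∷ lk) with addEdge-cases G u v _ _ e
... | inj₁ e' = e' ∷ addEdge-avoid G u v (j≢u ∷ avoid) lk
... | inj₂ (inj₁ (i≡u , _)) = ⊥-elim (i≢u i≡u)
... | inj₂ (inj₂ (_ , j≡u)) = ⊥-elim (j≢u j≡u)

bounded-by-head : ∀ {A : Set} (f : A → ℕ) {k x xs} → Linked (λ a b → f b ≤ f a) (x ∷ xs) →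
                  f x ≤ k → All (λ z → f z ≤ k) (x ∷ xs)
bounded-by-head f {xs = []} _ fx≤k = fx≤k ∷ []
bounded-by-head f {xs = _ ∷ _} (y≤x ∷ lk) fx≤k = fx≤k ∷ bounded-by-head f lk (≤-trans y≤x fx≤k)

rising : ∀ {A : Set} (f : A → ℕ) {k} a zs {y} → f a ≤ k → All (λ z → f z ≡ k) zs → k ≤ f y →
         Linked (λ a b → f a ≤ f b) (a ∷ (zs ∷ʳ y))
rising f a [] a≤k [] k≤y = ≤-trans a≤k k≤y ∷ [-]
rising f a (z ∷ zs) a≤k (refl ∷ flat) k≤y = a≤k ∷ rising f z zs ≤-refl flat k≤y

NonIncreasing : ∀ {n} → Graph n → List (Fin n) → Set
NonIncreasing G = Linked (λ a b → deg G b ≤ deg G a)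

module LeafToHub {N} (G : Graph N) (symG : Symmetric G) (u v w : Fin N) (t : List (Fin N))
  (hub : ∀ x → deg G x ≤ deg G u)
  (path : IsPath G (v ∷ w ∷ (t ∷ʳ u)))
  (leaf : ∀ {z} → Adj G v z → z ≡ w) where

  G' : Graph N
  G' = addEdge G u v

  u-last : u ∈ t ∷ʳ u
  u-last = ∈-++⁺ʳ t (here refl)

  u∈path : u ∈ w ∷ (t ∷ʳ u)
  u∈path = there u-last

  v∉ : v ∉ w ∷ (t ∷ʳ u)
  v∉ = Unique[x∷xs]⇒x∉xs (proj₁ path)

  w∉ : w ∉ t ∷ʳ u
  w∉ with proj₁ path
  ... | _ ∷ uq = Unique[x∷xs]⇒x∉xs uq

  u≢v : u ≢ v
  u≢v u≡v = v∉ (subst (_∈ _) u≡v u∈path)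

  ¬uv : ¬ Adj G u v
  ¬uv uv = w∉ (subst (_∈ t ∷ʳ u) (leaf (adj-sym symG uv)) u-last)

  inner-deg : All (λ z → 2 ≤ deg G z) (w ∷ t)
  inner-deg = interior-deg symG v (w ∷ t) u path

  hub-deg : 2 ≤ deg G u
  hub-deg = ≤-trans (All.head inner-deg) (hub w)

  path-deg : All (λ z → 2 ≤ deg G z) (w ∷ (t ∷ʳ u))
  path-deg = AllP.++⁺ inner-deg (hub-deg ∷ [])

  deg'-away : ∀ {x} → x ≢ u → x ≢ v → deg G' x ≡ deg G x
  deg'-away {x} x≢u x≢v = deg-cong G' G x x (addEdge-away G u v x≢u x≢v)

  hub-grows : suc (deg G u) ≤ deg G' u
  hub-grows = deg-grows G G' u v (λ _ → addEdge-old G u v) ¬uv (addEdge-uv G u v)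

  v-nbr' : ∀ {j} → Adj G' v j → j ≡ w ⊎ j ≡ u
  v-nbr' {j} e with addEdge-cases G u v v j e
  ... | inj₁ vj = inj₁ (leaf vj)
  ... | inj₂ (inj₁ (v≡u , _)) = ⊥-elim (u≢v (sym v≡u))
  ... | inj₂ (inj₂ (_ , j≡u)) = inj₂ j≡u

  v-deg' : deg G' v ≤ 2
  v-deg' = deg≤length G' v (w ∷ u ∷ []) nbrs
    where
    nbrs : ∀ j → Adj G' v j → j ∈ w ∷ u ∷ []
    nbrs j e with v-nbr' e
    ... | inj₁ j≡w = here j≡w
    ... | inj₂ j≡u = there (here j≡u)

  v-deg : deg G v ≤ 1
  v-deg = deg≤length G v (w ∷ []) λ j e → here (leaf e)

  -- u can only be the first vertex of a non-increasing path of G + uv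
  hub-first : ∀ {x} → x ≢ u → ¬ (deg G' u ≤ deg G' x)
  hub-first {x} x≢u = <⇒≱ (<-≤-trans (s≤s below-hub) hub-grows)
    where
    below-hub : deg G' x ≤ deg G u
    below-hub = by-cases (x ≟ v)
      where
      by-cases : Dec (x ≡ v) → deg G' x ≤ deg G u
      by-cases (yes refl) = ≤-trans v-deg' hub-deg
      by-cases (no x≢v) = subst (_≤ deg G u) (sym (deg'-away x≢u x≢v)) (hub x)

  small≢hub : ∀ {x} → deg G' x ≤ 2 → x ≢ u
  small≢hub x≤2 refl = <⇒≱ (<-≤-trans (s≤s hub-deg) hub-grows) x≤2

  follower≢hub : ∀ {a b} → a ≢ b → deg G' b ≤ deg G' a → b ≢ u
  follower≢hub a≢b b≤a refl = hub-first a≢b b≤a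

  -- A walk of G continuing the path p b ts from b, avoiding u, without repetitions and
  -- through vertices of degree ≤ 2, must follow the path: each of its vertices has no
  -- neighbours besides its two path neighbours.
  follows : ∀ p b ts rest → IsPath G (p ∷ b ∷ ts) → u ∈ b ∷ ts →
            Unique (p ∷ b ∷ rest) → Linked (Adj G) (b ∷ rest) →
            All (λ z → deg G z ≤ 2) (b ∷ rest) → All (_≢ u) (b ∷ rest) →
            ∃ λ s → b ∷ ts ≡ (b ∷ rest) ++ s
  follows p b ts [] _ _ _ _ _ _ = ts , refl
  follows p b [] (x ∷ rest) _ (here u≡b) _ _ _ (b≢u ∷ _) = ⊥-elim (b≢u (sym u≡b))
  follows p b (c ∷ ts) (x ∷ rest) ((_ ∷ p≢c ∷ _) ∷ path-uq , pb ∷ path-lk) u∈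
          ((_ ∷ p≢x ∷ _) ∷ uq) (bx ∷ lk) (b≤2 ∷ small) (b≢u ∷ avoid)
    with pin G b≤2 ((p≢c ∷ []) ∷ [] ∷ []) (adj-sym symG pb ∷ Linked.head path-lk ∷ []) bx
  ... | here x≡p = ⊥-elim (p≢x (sym x≡p))
  ... | there (here refl) =
    let (s , eq) = follows b c ts rest (path-uq , path-lk) (u∈-tail u∈) uq lk small avoid
    in s , cong (b ∷_) eq
    where
    u∈-tail : u ∈ b ∷ c ∷ ts → u ∈ c ∷ ts
    u∈-tail (here u≡b) = ⊥-elim (b≢u (sym u≡b))
    u∈-tail (there u∈) = u∈

  from-leaf : ∀ rest → Unique (v ∷ rest) → Linked (Adj G) (v ∷ rest) →
              All (λ z → deg G z ≤ 2) (v ∷ rest) → All (_≢ u) (v ∷ rest) →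
              ∃ λ s → v ∷ w ∷ (t ∷ʳ u) ≡ (v ∷ rest) ++ s
  from-leaf [] _ _ _ _ = w ∷ (t ∷ʳ u) , refl
  from-leaf (x ∷ rest) uq (vx ∷ lk) (_ ∷ small) (_ ∷ avoid) with leaf vx
  ... | refl = let (s , eq) = follows v w (t ∷ʳ u) rest path u∈path uq lk small avoid
               in s , cong (v ∷_) eq

  Dominated : List (Fin N) → Set
  Dominated R = ∃ λ Q → IsDegMonotonePath G Q × length R ≤ length Q

  -- A non-increasing path of G + uv starting at v stays at degree ≤ 2, so it runs along
  -- v w t towards u without reaching it; prolonged by the next path vertex y it becomes a
  -- non-decreasing path of G (degrees 1, 2, …, 2, ≥ 2) with one more vertex.
  from-v : ∀ rest → Unique (v ∷ rest) → Linked (Adj G') (v ∷ rest) → NonIncreasing G' (v ∷ rest) →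
           Dominated (u ∷ v ∷ rest)
  from-v rest uq@(v∉rest ∷ _) lk' ni = beyond (from-leaf rest uq lk small avoid)
    where
    small' : All (λ z → deg G' z ≤ 2) (v ∷ rest)
    small' = bounded-by-head (deg G') ni v-deg'
    avoid : All (_≢ u) (v ∷ rest)
    avoid = All.map small≢hub small'
    lk : Linked (Adj G) (v ∷ rest)
    lk = addEdge-avoid G u v avoid lk'
    small : All (λ z → deg G z ≤ 2) (v ∷ rest)
    small = ≤-trans v-deg (n≤1+n 1) ∷ All.tabulate λ {z} z∈ →
      subst (_≤ 2) (deg'-away (All.lookup avoid (there z∈)) (λ z≡v → All.lookup v∉rest z∈ (sym z≡v)))
        (All.lookup small' (there z∈))
    beyond : (∃ λ s → v ∷ w ∷ (t ∷ʳ u) ≡ (v ∷ rest) ++ s) → Dominated (u ∷ v ∷ rest)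
    beyond ([] , eq) =
      ⊥-elim (All.lookup avoid (subst (u ∈_) (trans eq (++-identityʳ _)) (there u∈path)) refl)
    beyond (y ∷ s , eq) = v ∷ (rest ∷ʳ y) , (Q-path , inj₁ Q-rising) , ≤-reflexive length-Q
      where
      Q-path : IsPath G (v ∷ (rest ∷ʳ y))
      Q-path = path-prefix (v ∷ (rest ∷ʳ y)) (subst (IsPath G) (trans eq (sym (++-assoc (v ∷ rest) _ s))) path)
      rest-deg : All (λ z → 2 ≤ deg G z) (rest ++ y ∷ s)
      rest-deg = subst (All _) (∷-injectiveʳ eq) path-deg
      flat : All (λ z → deg G z ≡ 2) rest
      flat = All.zipWith (λ (≤2 , ≥2) → ≤-antisym ≤2 ≥2) (All.tail small , AllP.++⁻ˡ rest rest-deg)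
      Q-rising : Linked (λ a b → deg G a ≤ deg G b) (v ∷ (rest ∷ʳ y))
      Q-rising = rising (deg G) v rest (All.head small) flat (All.head (AllP.++⁻ʳ rest rest-deg))
      length-Q : length (u ∷ v ∷ rest) ≡ length (v ∷ (rest ∷ʳ y))
      length-Q = cong suc (trans (+-comm 1 (length rest)) (sym (length-++ rest)))

  step : ∀ {a b} → Adj G' a b → deg G' b ≤ deg G' a → a ≢ v → (a ≡ u → b ≢ v) →
         Adj G a b × deg G b ≤ deg G a
  step {a} {b} e b≤a a≢v not-uv = ab , degree (a ≟ u) (b ≟ u) (b ≟ v)
    where
    ab : Adj G a b
    ab with addEdge-cases G u v a b e
    ... | inj₁ ab = ab
    ... | inj₂ (inj₁ (a≡u , b≡v)) = ⊥-elim (not-uv a≡u b≡v)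
    ... | inj₂ (inj₂ (a≡v , _)) = ⊥-elim (a≢v a≡v)
    degree : Dec (a ≡ u) → Dec (b ≡ u) → Dec (b ≡ v) → deg G b ≤ deg G a
    degree (yes refl) _ _ = hub b
    degree (no a≢u) (yes refl) _ = ⊥-elim (hub-first a≢u b≤a)
    degree (no a≢u) (no _) (yes refl) = ≤-trans v-deg (length≤deg G a ([] ∷ []) (ab ∷ []))
    degree (no a≢u) (no b≢u) (no b≢v) = subst₂ _≤_ (deg'-away b≢u b≢v) (deg'-away a≢u a≢v) b≤a

  -- The invariant for transferring a path: its first vertex is not v, and if it is u then
  -- the second one is not v.  Only the last vertex of such a path can be v.
  Safe : Fin N → List (Fin N) → Set
  Safe a [] = ⊤
  Safe a (b ∷ _) = a ≢ v × (a ≡ u → b ≢ v)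

  descend : ∀ a rest → Unique (a ∷ rest) → Linked (Adj G') (a ∷ rest) → NonIncreasing G' (a ∷ rest) →
            Safe a rest → Linked (Adj G) (a ∷ rest) × NonIncreasing G (a ∷ rest)
  descend a [] _ _ _ _ = [-] , [-]
  descend a (b ∷ []) _ (e ∷ [-]) (b≤a ∷ [-]) (a≢v , not-uv) =
    let (ab , b≤aG) = step e b≤a a≢v not-uv in ab ∷ [-] , b≤aG ∷ [-]
  descend a (b ∷ c ∷ rest) ((a≢b ∷ a≢c ∷ _) ∷ uq@((b≢c ∷ _) ∷ _)) (e ∷ lk) (b≤a ∷ ni) (a≢v , not-uv) =
    let (ab , b≤aG) = step e b≤a a≢v not-uv
        (lkG , niG) = descend b (c ∷ rest) uq lk ni (b≢v ab , λ b≡u → ⊥-elim (b≢u b≡u))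
    in ab ∷ lkG , b≤aG ∷ niG
    where
    b≢u : b ≢ u
    b≢u = follower≢hub a≢b b≤a
    -- v could only be entered from w, and could then only be left to w or to u
    b≢v : Adj G a b → b ≢ v
    b≢v ab refl with v-nbr' (Linked.head lk)
    ... | inj₁ c≡w = a≢c (trans (leaf (adj-sym symG ab)) (sym c≡w))
    ... | inj₂ c≡u = follower≢hub b≢c (Linked.head ni) c≡u

  transfer : ∀ a rest → Unique (a ∷ rest) → Linked (Adj G') (a ∷ rest) → NonIncreasing G' (a ∷ rest) →
             Safe a rest → Dominated (a ∷ rest)
  transfer a rest uq lk ni safe =
    let (lkG , niG) = descend a rest uq lk ni safe in a ∷ rest , ((uq , lkG) , inj₂ niG) , ≤-refl

  descending : ∀ R → Unique R → Linked (Adj G') R → NonIncreasing G' R → Dominated R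
  descending [] _ _ _ = [] , (([] , []) , inj₁ []) , z≤n
  descending (a ∷ []) _ _ _ = a ∷ [] , (([] ∷ [] , [-]) , inj₁ [-]) , ≤-refl
  descending (a ∷ b ∷ rest) uq lk ni with a ≟ v | a ≟ u | b ≟ v
  ... | yes refl | _ | _ =
    let (Q , mono , longer) = from-v (b ∷ rest) uq lk ni in Q , mono , ≤-trans (n≤1+n _) longer
  ... | no _ | yes refl | yes refl = from-v rest (Unique.tail uq) (Linked.tail lk) (Linked.tail ni)
  ... | no a≢v | yes refl | no b≢v = transfer a (b ∷ rest) uq lk ni (a≢v , λ _ → b≢v)
  ... | no a≢v | no a≢u | _ = transfer a (b ∷ rest) uq lk ni (a≢v , λ a≡u → ⊥-elim (a≢u a≡u))

  dominated : ∀ R → IsDegMonotonePath G' R → Dominated R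
  dominated R ((uq , lk) , inj₂ ni) = descending R uq lk ni
  dominated R ((uq , lk) , inj₁ nd) =
    let (Q , mono , longer) = descending (reverse R) (unique-reverse uq)
                                (Linked.map (adj-sym (addEdge-sym u v symG)) (linked-reverse lk))
                                (linked-reverse nd)
    in Q , mono , subst (_≤ length Q) (length-reverse R) longer

  not-saturated : ¬ Saturated G
  not-saturated sat with mp-exists G | mp-exists G'
  ... | m , mp | m' , mp'@((R , mono , refl) , _) =
    let (Q , monoQ , longer) = dominated R mono
    in <⇒≱ (sat u v u≢v ¬uv m m' mp mp') (≤-trans longer (proj₂ mp Q monoQ))

no-chord : ∀ {n} {G : Graph n} → Acyclic G → ∀ {x y rest z} → IsPath G (x ∷ y ∷ rest) → z ∈ rest → ¬ Adj G z x
no-chord {G = G} acyc {x} {y} {z = z} path z∈ zx with ∈-∃++ z∈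
... | pre , post , refl = acyc (x ∷ y ∷ (pre ∷ʳ z)) (three , cycle-path , linked-snoc (x ∷ y ∷ pre) (proj₂ cycle-path) zx)
  where
  cycle-path : IsPath G (x ∷ y ∷ (pre ∷ʳ z))
  cycle-path = path-prefix (x ∷ y ∷ (pre ∷ʳ z))
    (subst (IsPath G) (cong (λ r → x ∷ y ∷ r) (sym (++-assoc pre (z ∷ []) post))) path)
  three : 3 ≤ length (x ∷ y ∷ (pre ∷ʳ z))
  three = s≤s (s≤s (subst (1 ≤_) (sym (length-++ pre)) (m≤n+m 1 (length pre))))

Dominating : ∀ {n} → Graph n → Fin n → Set
Dominating G c = ∀ j → j ≡ c ⊎ Adj G c j

dominating? : ∀ {n} (G : Graph n) c → Dec (Dominating G c)
dominating? G c = all? (λ j → (j ≟ c) ⊎-dec (G c j Bool.≟ true))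

-- In a simple acyclic graph a dominating vertex is a centre: an edge ij avoiding c would
-- close the triangle c i j.
dominating-centre : ∀ {n} {G : Graph n} {c} → IsSimple G → Acyclic G → Dominating G c → Centre G c
dominating-centre {G = G} {c} (symG , loopless) acyc dom = hub , rim
  where
  hub : ∀ j → j ≢ c → Adj G c j
  hub j j≢c with dom j
  ... | inj₁ j≡c = ⊥-elim (j≢c j≡c)
  ... | inj₂ cj = cj
  rim : ∀ i j → i ≢ c → j ≢ c → ¬ Adj G i j
  rim i j i≢c j≢c ij = no-chord acyc triangle (here refl) (adj-sym symG (hub j j≢c))
    where
    triangle : IsPath G (c ∷ i ∷ j ∷ [])
    triangle = ((i≢c ∘ sym ∷ j≢c ∘ sym ∷ []) ∷ (adj-irrefl loopless ij ∷ []) ∷ [] ∷ []) ,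
               hub i i≢c ∷ ij ∷ [-]

max-degree : ∀ {m} (G : Graph (suc m)) → ∃ λ u → ∀ x → deg G x ≤ deg G u
max-degree {m} G = argmax (deg G) zero (allFin (suc m)) ,
                   λ x → All.lookup (f[xs]≤f[argmax] {f = deg G} zero (allFin (suc m))) (∈-allFin x)

-- Take u of maximum degree and a
-- longest path v w t u ending at u; it has at least three vertices because some vertex is
-- at distance ≥ 2 from u, and v is a leaf by maximality and acyclicity.
module NonStarTree {n} (T : Graph n) (simple : IsSimple T) (conn : Connected T) (acyc : Acyclic T)
  (no-centre : ¬ ∃ (Dominating T)) (u : Fin n) (hub : ∀ x → deg T x ≤ deg T u) where

  symT : Symmetric T
  symT = proj₁ simple

  Near : Fin n → Set
  Near x = x ≡ u ⊎ Adj T u x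

  near? : ∀ x → Dec (Near x)
  near? x = (x ≟ u) ⊎-dec (T u x Bool.≟ true)

  -- a walk from N[u] to a vertex outside N[u] leaves N[u] along an edge a b with a ∈ N(u)
  Exit : Set
  Exit = ∃ λ a → ∃ λ b → Adj T u a × Adj T a b × ¬ Near b

  exit-step : ∀ {y z} → Near y → ¬ Near z → Adj T y z → Exit
  exit-step (inj₁ refl) ¬nz yz = ⊥-elim (¬nz (inj₂ yz))
  exit-step (inj₂ uy) ¬nz yz = _ , _ , uy , yz , ¬nz

  exit : ∀ y xs {x} → Near y → Linked (Adj T) (y ∷ (xs ∷ʳ x)) → ¬ Near x → Exit
  exit y [] ny (yx ∷ [-]) ¬nx = exit-step ny ¬nx yx
  exit y (z ∷ zs) ny (yz ∷ lk) ¬nx with near? z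
  ... | yes nz = exit z zs nz lk ¬nx
  ... | no ¬nz = exit-step ny ¬nz yz

  ToHub : List (Fin n) → Set
  ToHub ys = IsPath T (ys ∷ʳ u)

  three-path : ∃ λ ys → ToHub ys × length ys ≡ 2
  three-path with ¬∀⟶∃¬ _ Near near? (λ dom → no-centre (u , dom))
  ... | x , ¬nx with conn u x
  ...   | inj₁ u≡x = ⊥-elim (¬nx (inj₁ (sym u≡x)))
  ...   | inj₂ (xs , lk) with exit u xs (inj₁ refl) lk ¬nx
  ...     | a , b , ua , ab , ¬nb =
    b ∷ a ∷ [] , (distinct , adj-sym symT ab ∷ adj-sym symT ua ∷ [-]) , refl
    where
    distinct : Unique (b ∷ a ∷ u ∷ [])
    distinct = ((adj-irrefl (proj₂ simple) ab ∘ sym ∷ ¬nb ∘ inj₁ ∷ []) ∷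
                (adj-irrefl (proj₂ simple) ua ∘ sym ∷ []) ∷ [] ∷ [])

  -- The end v of a longest path v w t u is a leaf with unique neighbour w: a neighbour off
  -- the path would extend it, and a neighbour further along would close a cycle.
  from-longest : ∀ ys → Longest ToHub ys → 2 ≤ length ys → ¬ Saturated T
  from-longest (_ ∷ []) _ (s≤s ())
  from-longest (v ∷ w ∷ t) (path , longest) _ = LeafToHub.not-saturated T symT u v w t hub path leaf
    where
    leaf : ∀ {z} → Adj T v z → z ≡ w
    leaf {z} vz with MemDec._∈?_ _≟_ z (v ∷ w ∷ (t ∷ʳ u))
    ... | yes (here z≡v) = ⊥-elim (adj-irrefl (proj₂ simple) vz (sym z≡v))
    ... | yes (there (here z≡w)) = z≡w
    ... | yes (there (there z∈)) = ⊥-elim (no-chord acyc path z∈ (adj-sym symT vz))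
    ... | no z∉ = ⊥-elim (<⇒≱ ≤-refl (longest (z ∷ v ∷ w ∷ t) longer))
      where
      longer : ToHub (z ∷ v ∷ w ∷ t)
      longer = (AllP.¬Any⇒All¬ _ z∉ ∷ proj₁ path) , adj-sym symT vz ∷ proj₂ path

  not-saturated : ¬ Saturated T
  not-saturated with longest ToHub (λ ys → path? T (ys ∷ʳ u)) ([] ∷ [] , [-]) (λ ys → unique-prefix ys ∘ proj₁)
  ... | ys , to-hub , longest-ys =
    let (zs , zs-to-hub , length-zs) = three-path
    in from-longest ys (to-hub , longest-ys) (subst (_≤ length ys) length-zs (longest-ys zs zs-to-hub))

corollary2p3 : (m : ℕ) → 2 ≤ m → (T : Graph (suc m)) → IsTree T →
    Saturated T ⇔ Isomorphic T (Star m)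
corollary2p3 m _ T (simple , conn , acyc) = mk⇔ saturated⇒star star⇒saturated
  where
  star⇒saturated : Isomorphic T (Star m) → Saturated T
  star⇒saturated iso =
    let (c , star) = Equivalence.to (star-iso T) iso
    in StarSaturated.saturated T (proj₁ simple) c (star⇒centre star)
  saturated⇒star : Saturated T → Isomorphic T (Star m)
  saturated⇒star sat with any? (dominating? T)
  ... | yes (c , dom) = Equivalence.from (star-iso T) (c , centre⇒star simple (dominating-centre simple acyc dom))
  ... | no no-centre =
    let (u , hub) = max-degree T
    in ⊥-elim (NonStarTree.not-saturated T simple conn acyc no-centre u hub sat)
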